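{- Let $n\ge 2$ be an integer and let $(W_r)_{r\in\mathbb{Z}}$ be any generalized $n$-step Fibonacci sequence. Then for every nonnegative integer $k$ and every integer $r$, \[ \sum_{j=0}^{k}(-1)^j\binom kj2^jW_{r-(n+1)k+nj}=(-1)^kW_r, \] \[ \sum_{j=0}^{k}\binom kjW_{r-nk+(n+1)j}=2^kW_r, \] and \[ \sum_{j=0}^{k}(-1)^j\binom kj2^{k-j}W_{r+nk+j}=W_r. \]
   Context: A generalized $n$-step Fibonacci sequence is any sequence $(W_r)_{r\in\mathbb{Z}}$ of complex numbers satisfying $W_r=\sum_{i=1}^{n}W_{r-i}$ for all $r\in\mathbb{Z}$. -}

module Defs where

open import Level using (Level)
open import Data.Nat using (ℕ; zero; suc)
open import Data.Integer as ℤ using (ℤ; +_)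
open import Algebra.Bundles using (CommutativeRing)

module _ {c ℓ : Level} (R : CommutativeRing c ℓ) where
  open CommutativeRing R

  natR : ℕ → Carrier
  natR zero    = 0#
  natR (suc n) = 1# + natR n

  neg1^ : ℕ → Carrier
  neg1^ zero    = 1#
  neg1^ (suc j) = - neg1^ j

  two^ : ℕ → Carrier
  two^ zero    = 1#
  two^ (suc j) = (1# + 1#) * two^ j

  sumBelow : ℕ → (ℕ → Carrier) → Carrier
  sumBelow zero    f = 0#
  sumBelow (suc m) f = sumBelow m f + f m

  IsNStepFib : ℕ → (ℤ → Carrier) → Set ℓ
  IsNStepFib n W = ∀ (r : ℤ) → W r ≈ sumBelow n (λ i → W (r ℤ.- + suc i))

-- The recurrences at r + 1 and at r share the terms W (r - 1), ...,
-- W (r - n + 1), so they combine into W (r + 1) + W (r - n) = 2 W r.  Each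
-- of the three identities comes from this relation, suitably shifted and
-- rearranged into the form a W m + b W (m + d) = c W (m + e) for all m;
-- iterating such a relation k times expands, exactly as in the binomial
-- theorem, to Σ_j C(k,j) a^(k-j) b^j W (m + j d) = c^k W (m + k e).
{-# OPTIONS --safe #-}
module Submission where

open import Defs
open import Level using (Level)
open import Data.Nat using (ℕ; suc; _≤_; _*_; _∸_)
open import Data.Nat.Combinatorics using (_C_)
open import Data.Integer as ℤ using (ℤ; +_)
open import Data.Product using (_×_)
open import Algebra.Bundles using (CommutativeRing)

open import Data.Nat as ℕ using (zero; _<_)
import Data.Nat.Properties as ℕ
open import Data.Nat.Combinatorics using (nCk+nC[k+1]≡[n+1]C[k+1]; k>n⇒nCk≡0)
import Data.Integer.Properties as ℤ
open import Data.Integer.Tactic.RingSolver using (solve-∀)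
open import Data.Product using (_,_)
open import Function using (_∘_)
import Relation.Binary.PropositionalEquality as ≡
open ≡ using (_≡_)

m+d*0≡m : ∀ m d → m ℤ.+ d ℤ.* + 0 ≡ m
m+d*0≡m m d = ≡.trans (≡.cong (λ t → m ℤ.+ t) (ℤ.*-zeroʳ d)) (ℤ.+-identityʳ m)

m+d*[1+x]≡[m+d]+d*x : ∀ m d x → m ℤ.+ d ℤ.* (+ 1 ℤ.+ x) ≡ (m ℤ.+ d) ℤ.+ d ℤ.* x
m+d*[1+x]≡[m+d]+d*x = solve-∀

[m+d]+e*x≡[m+e*x]+d : ∀ m d e x → (m ℤ.+ d) ℤ.+ e ℤ.* x ≡ (m ℤ.+ e ℤ.* x) ℤ.+ d
[m+d]+e*x≡[m+e*x]+d = solve-∀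

[m+e*x]+e≡m+e*[1+x] : ∀ m e x → (m ℤ.+ e ℤ.* x) ℤ.+ e ≡ m ℤ.+ e ℤ.* (+ 1 ℤ.+ x)
[m+e*x]+e≡m+e*[1+x] = solve-∀

[m+1]-1≡m : ∀ m → (m ℤ.+ + 1) ℤ.- + 1 ≡ m
[m+1]-1≡m = solve-∀

[m+1]-[1+x]≡m-x : ∀ m x → (m ℤ.+ + 1) ℤ.- (+ 1 ℤ.+ x) ≡ m ℤ.- x
[m+1]-[1+x]≡m-x = solve-∀

[m+x]+1≡m+[1+x] : ∀ m x → (m ℤ.+ x) ℤ.+ + 1 ≡ m ℤ.+ (+ 1 ℤ.+ x)
[m+x]+1≡m+[1+x] = solve-∀

[m+x]-x≡m : ∀ m x → (m ℤ.+ x) ℤ.- x ≡ m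
[m+x]-x≡m = solve-∀

[r-ab]+ab≡r : ∀ r a b → (r ℤ.- + (a * b)) ℤ.+ + a ℤ.* + b ≡ r
[r-ab]+ab≡r r a b =
  ≡.trans (≡.cong (λ t → (r ℤ.- t) ℤ.+ + a ℤ.* + b) (ℤ.pos-* a b)) (identity r (+ a) (+ b))
  where
  identity : ∀ r x y → (r ℤ.- x ℤ.* y) ℤ.+ x ℤ.* y ≡ r
  identity = solve-∀

[r+ab]-ab≡r : ∀ r a b → (r ℤ.+ + (a * b)) ℤ.+ ℤ.- + a ℤ.* + b ≡ r
[r+ab]-ab≡r r a b =
  ≡.trans (≡.cong (λ t → (r ℤ.+ t) ℤ.+ ℤ.- + a ℤ.* + b) (ℤ.pos-* a b)) (identity r (+ a) (+ b))
  where
  identity : ∀ r x y → (r ℤ.+ x ℤ.* y) ℤ.+ ℤ.- x ℤ.* y ≡ r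
  identity = solve-∀

module _ {c ℓ : Level} (R : CommutativeRing c ℓ) where
  open CommutativeRing R renaming (_*_ to _·_)
  open import Algebra.Properties.Ring ring using (-1*x≈-x)
  open import Algebra.Properties.AbelianGroup +-abelianGroup using (xyx⁻¹≈y; ⁻¹-∙-comm)
  open import Algebra.Properties.CommutativeSemiring.Exp commutativeSemiring
    using (_^_; ^-distrib-*)
  open import Relation.Binary.Reasoning.Setoid setoid
  open import Algebra.Solver.Ring.NaturalCoefficients.Default commutativeSemiring
    using (solve; _:=_; _:+_; _:*_)

  sumBelow-cong-< : ∀ m {f g : ℕ → Carrier} → (∀ j → j < m → f j ≈ g j) →
                    sumBelow R m f ≈ sumBelow R m g
  sumBelow-cong-< zero    f≈g = refl
  sumBelow-cong-< (suc m) f≈g =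
    +-cong (sumBelow-cong-< m (λ j j<m → f≈g j (ℕ.m<n⇒m<1+n j<m))) (f≈g m (ℕ.n<1+n m))

  sumBelow-cong : ∀ m {f g : ℕ → Carrier} → (∀ j → f j ≈ g j) →
                  sumBelow R m f ≈ sumBelow R m g
  sumBelow-cong m f≈g = sumBelow-cong-< m (λ j _ → f≈g j)

  sumBelow-distrib-+ : ∀ m f g →
    sumBelow R m (λ j → f j + g j) ≈ sumBelow R m f + sumBelow R m g
  sumBelow-distrib-+ zero    f g = sym (+-identityˡ 0#)
  sumBelow-distrib-+ (suc m) f g = trans (+-congʳ (sumBelow-distrib-+ m f g)) (interchange _ _ _ _)
    where
    interchange : ∀ A B x y → (A + B) + (x + y) ≈ (A + x) + (B + y)
    interchange = solve 4 (λ A B x y → (A :+ B) :+ (x :+ y) := (A :+ x) :+ (B :+ y)) refl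

  *-distribˡ-sumBelow : ∀ m x f → x · sumBelow R m f ≈ sumBelow R m (λ j → x · f j)
  *-distribˡ-sumBelow zero    x f = zeroʳ x
  *-distribˡ-sumBelow (suc m) x f = trans (distribˡ x _ _) (+-congʳ (*-distribˡ-sumBelow m x f))

  sumBelow-sucˡ : ∀ m f → sumBelow R (suc m) f ≈ f 0 + sumBelow R m (f ∘ suc)
  sumBelow-sucˡ zero    f = +-comm 0# (f 0)
  sumBelow-sucˡ (suc m) f = trans (+-congʳ (sumBelow-sucˡ m f)) (+-assoc _ _ _)

  natR-homo-+ : ∀ m n → natR R (m ℕ.+ n) ≈ natR R m + natR R n
  natR-homo-+ zero    n = sym (+-identityˡ _)
  natR-homo-+ (suc m) n = trans (+-congˡ (natR-homo-+ m n)) (sym (+-assoc _ _ _))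

  1^n≈1 : ∀ n → 1# ^ n ≈ 1#
  1^n≈1 zero    = refl
  1^n≈1 (suc n) = trans (*-congˡ (1^n≈1 n)) (*-identityˡ 1#)

  [-1]^n≈neg1^n : ∀ n → (- 1#) ^ n ≈ neg1^ R n
  [-1]^n≈neg1^n zero    = refl
  [-1]^n≈neg1^n (suc n) = trans (*-congˡ ([-1]^n≈neg1^n n)) (-1*x≈-x _)

  2^n≈two^n : ∀ n → (1# + 1#) ^ n ≈ two^ R n
  2^n≈two^n zero    = refl
  2^n≈two^n (suc n) = *-congˡ (2^n≈two^n n)

  -- binomialSum k x y f = ((x + y S)^k f) 0, where S is the shift f ↦ f ∘ suc.
  binomialSum : ℕ → Carrier → Carrier → (ℕ → Carrier) → Carrier
  binomialSum k x y f = sumBelow R (suc k) (λ j → natR R (k C j) · (x ^ (k ∸ j) · (y ^ j · f j)))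

  binomialSum-cong : ∀ k x y {f g : ℕ → Carrier} → (∀ j → f j ≈ g j) →
                     binomialSum k x y f ≈ binomialSum k x y g
  binomialSum-cong k x y f≈g = sumBelow-cong (suc k) (λ j → *-congˡ (*-congˡ (*-congˡ (f≈g j))))

  binomialSum-suc : ∀ k x y f →
    binomialSum (suc k) x y f ≈ x · binomialSum k x y f + y · binomialSum k x y (f ∘ suc)
  binomialSum-suc k x y f = begin
      sumBelow R (suc (suc k)) term
    ≈⟨ sumBelow-sucˡ (suc k) term ⟩
      xTerm 0 + sumBelow R (suc k) (term ∘ suc)
    ≈⟨ +-congˡ (sumBelow-cong (suc k) pascal) ⟩
      xTerm 0 + sumBelow R (suc k) (λ j → yTerm j + xTerm (suc j))
    ≈⟨ +-congˡ (sumBelow-distrib-+ (suc k) yTerm (xTerm ∘ suc)) ⟩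
      xTerm 0 + (sumBelow R (suc k) yTerm + sumBelow R (suc k) (xTerm ∘ suc))
    ≈⟨ rotate _ _ _ ⟩
      (xTerm 0 + sumBelow R (suc k) (xTerm ∘ suc)) + sumBelow R (suc k) yTerm
    ≈⟨ +-congʳ (sym (sumBelow-sucˡ (suc k) xTerm)) ⟩
      sumBelow R (suc (suc k)) xTerm + sumBelow R (suc k) yTerm
    ≈⟨ +-cong xPart yPart ⟩
      x · binomialSum k x y f + y · binomialSum k x y (f ∘ suc)
    ∎
    where
    term xTerm yTerm : ℕ → Carrier
    term  j = natR R (suc k C j) · (x ^ (suc k ∸ j) · (y ^ j · f j))
    xTerm j = natR R (k C j) · (x ^ (suc k ∸ j) · (y ^ j · f j))
    yTerm j = natR R (k C j) · (x ^ (k ∸ j) · (y ^ suc j · f (suc j)))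

    rotate : ∀ a b c → a + (b + c) ≈ (a + c) + b
    rotate = solve 3 (λ a b c → a :+ (b :+ c) := (a :+ c) :+ b) refl

    pascal : ∀ j → term (suc j) ≈ yTerm j + xTerm (suc j)
    pascal j = begin
        natR R (suc k C suc j) · _
      ≈˘⟨ *-congʳ (reflexive (≡.cong (natR R) (nCk+nC[k+1]≡[n+1]C[k+1] k j))) ⟩
        natR R (k C j ℕ.+ k C suc j) · _
      ≈⟨ trans (*-congʳ (natR-homo-+ (k C j) (k C suc j))) (distribʳ _ _ _) ⟩
        yTerm j + xTerm (suc j)
      ∎

    pull-x : ∀ a C p X → C · ((a · p) · X) ≈ a · (C · (p · X))
    pull-x = solve 4 (λ a C p X → C :* ((a :* p) :* X) := a :* (C :* (p :* X))) refl

    xPart : sumBelow R (suc (suc k)) xTerm ≈ x · binomialSum k x y f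
    xPart = begin
        sumBelow R (suc k) xTerm + xTerm (suc k)
      ≈⟨ +-congˡ (trans (*-congʳ (reflexive (≡.cong (natR R) (k>n⇒nCk≡0 (ℕ.n<1+n k))))) (zeroˡ _)) ⟩
        sumBelow R (suc k) xTerm + 0#
      ≈⟨ +-identityʳ _ ⟩
        sumBelow R (suc k) xTerm
      ≈⟨ sumBelow-cong-< (suc k) (λ j j<1+k → trans
           (reflexive (≡.cong (λ t → natR R (k C j) · (x ^ t · (y ^ j · f j)))
                              (ℕ.+-∸-assoc 1 (ℕ.≤-pred j<1+k))))
           (pull-x x (natR R (k C j)) (x ^ (k ∸ j)) (y ^ j · f j))) ⟩
        sumBelow R (suc k) (λ j → x · (natR R (k C j) · (x ^ (k ∸ j) · (y ^ j · f j))))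
      ≈˘⟨ *-distribˡ-sumBelow (suc k) x _ ⟩
        x · binomialSum k x y f
      ∎

    yPart : sumBelow R (suc k) yTerm ≈ y · binomialSum k x y (f ∘ suc)
    yPart = sym (trans (*-distribˡ-sumBelow (suc k) y _)
                       (sumBelow-cong (suc k) (λ j → push-y y _ _ _ _)))
      where
      push-y : ∀ b C p q X → b · (C · (p · (q · X))) ≈ C · (p · ((b · q) · X))
      push-y = solve 5 (λ b C p q X → b :* (C :* (p :* (q :* X))) := C :* (p :* ((b :* q) :* X))) refl

  module _ (W : ℤ → Carrier) {a b c : Carrier} {d e : ℤ}
           (recurrence : ∀ m → a · W m + b · W (m ℤ.+ d) ≈ c · W (m ℤ.+ e)) where

    private
      W-cong : ∀ {m m′} → m ≡ m′ → W m ≈ W m′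
      W-cong = reflexive ∘ ≡.cong W

    binomialSum-recurrence : ∀ k m →
      binomialSum k a b (λ j → W (m ℤ.+ d ℤ.* + j)) ≈ c ^ k · W (m ℤ.+ e ℤ.* + k)
    binomialSum-recurrence zero m = begin
        0# + (1# + 0#) · (1# · (1# · W (m ℤ.+ d ℤ.* + 0)))
      ≈⟨ +-identityˡ _ ⟩
        (1# + 0#) · (1# · (1# · W (m ℤ.+ d ℤ.* + 0)))
      ≈⟨ *-cong (+-identityʳ 1#) (trans (*-identityˡ _) (*-identityˡ _)) ⟩
        1# · W (m ℤ.+ d ℤ.* + 0)
      ≈⟨ *-congˡ (W-cong (≡.trans (m+d*0≡m m d) (≡.sym (m+d*0≡m m e)))) ⟩
        1# · W (m ℤ.+ e ℤ.* + 0)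
      ∎
    binomialSum-recurrence (suc k) m = begin
        binomialSum (suc k) a b (λ j → W (m ℤ.+ d ℤ.* + j))
      ≈⟨ binomialSum-suc k a b _ ⟩
        a · binomialSum k a b (λ j → W (m ℤ.+ d ℤ.* + j))
          + b · binomialSum k a b (λ j → W (m ℤ.+ d ℤ.* + suc j))
      ≈⟨ +-congˡ (*-congˡ (binomialSum-cong k a b (λ j → W-cong (m+d*[1+x]≡[m+d]+d*x m d (+ j))))) ⟩
        a · binomialSum k a b (λ j → W (m ℤ.+ d ℤ.* + j))
          + b · binomialSum k a b (λ j → W ((m ℤ.+ d) ℤ.+ d ℤ.* + j))
      ≈⟨ +-cong (*-congˡ (binomialSum-recurrence k m)) (*-congˡ (binomialSum-recurrence k (m ℤ.+ d))) ⟩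
        a · (c ^ k · W m′) + b · (c ^ k · W ((m ℤ.+ d) ℤ.+ e ℤ.* + k))
      ≈⟨ +-congˡ (*-congˡ (*-congˡ (W-cong ([m+d]+e*x≡[m+e*x]+d m d e (+ k))))) ⟩
        a · (c ^ k · W m′) + b · (c ^ k · W (m′ ℤ.+ d))
      ≈⟨ factor a b (c ^ k) (W m′) (W (m′ ℤ.+ d)) ⟩
        c ^ k · (a · W m′ + b · W (m′ ℤ.+ d))
      ≈⟨ *-congˡ (recurrence m′) ⟩
        c ^ k · (c · W (m′ ℤ.+ e))
      ≈⟨ reassoc (c ^ k) c _ ⟩
        c ^ suc k · W (m′ ℤ.+ e)
      ≈⟨ *-congˡ (W-cong ([m+e*x]+e≡m+e*[1+x] m e (+ k))) ⟩
        c ^ suc k · W (m ℤ.+ e ℤ.* + suc k)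
      ∎
      where
      m′ = m ℤ.+ e ℤ.* + k
      factor : ∀ a b p X Y → a · (p · X) + b · (p · Y) ≈ p · (a · X + b · Y)
      factor = solve 5 (λ a b p X Y → a :* (p :* X) :+ b :* (p :* Y) := p :* (a :* X :+ b :* Y)) refl
      reassoc : ∀ p c X → p · (c · X) ≈ (c · p) · X
      reassoc = solve 3 (λ p c X → p :* (c :* X) := (c :* p) :* X) refl

  [1+1]·x≈x+x : ∀ x → (1# + 1#) · x ≈ x + x
  [1+1]·x≈x+x x = trans (distribʳ x 1# 1#) (+-cong (*-identityˡ x) (*-identityˡ x))

  module _ (p : ℕ) (W : ℤ → Carrier) (fib : IsNStepFib R (suc p) W) where
    private
      n = suc p
      W-cong : ∀ {m m′} → m ≡ m′ → W m ≈ W m′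
      W-cong = reflexive ∘ ≡.cong W

    W[m+1]+W[m-n]≈W[m]+W[m] : ∀ m → W (m ℤ.+ + 1) + W (m ℤ.- + n) ≈ W m + W m
    W[m+1]+W[m-n]≈W[m]+W[m] m = begin
        W (m ℤ.+ + 1) + W (m ℤ.- + n)
      ≈⟨ +-congʳ W[m+1]≈W[m]+tail ⟩
        (W m + tail) + W (m ℤ.- + n)
      ≈⟨ +-assoc _ _ _ ⟩
        W m + (tail + W (m ℤ.- + n))
      ≈˘⟨ +-congˡ (fib m) ⟩
        W m + W m
      ∎
      where
      tail : Carrier
      tail = sumBelow R p (λ i → W (m ℤ.- + suc i))
      W[m+1]≈W[m]+tail : W (m ℤ.+ + 1) ≈ W m + tail
      W[m+1]≈W[m]+tail = trans (fib (m ℤ.+ + 1)) (trans (sumBelow-sucˡ p _)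
        (+-cong (W-cong ([m+1]-1≡m m))
                (sumBelow-cong p (λ i → W-cong ([m+1]-[1+x]≡m-x m (+ suc i))))))

    W[m+n+1]+W[m]≈W[m+n]+W[m+n] : ∀ m → W (m ℤ.+ + suc n) + W m ≈ W (m ℤ.+ + n) + W (m ℤ.+ + n)
    W[m+n+1]+W[m]≈W[m+n]+W[m+n] m =
      trans (+-cong (W-cong (≡.sym ([m+x]+1≡m+[1+x] m (+ n)))) (W-cong (≡.sym ([m+x]-x≡m m (+ n)))))
            (W[m+1]+W[m-n]≈W[m]+W[m] (m ℤ.+ + n))

    W[m]-2W[m+n]≈-W[m+n+1] : ∀ m →
      1# · W m + (- 1# · (1# + 1#)) · W (m ℤ.+ + n) ≈ - 1# · W (m ℤ.+ + suc n)
    W[m]-2W[m+n]≈-W[m+n+1] m = begin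
        1# · W m + (- 1# · (1# + 1#)) · W (m ℤ.+ + n)
      ≈⟨ +-cong (*-identityˡ _) (trans (*-assoc _ _ _) (-1*x≈-x _)) ⟩
        W m + - ((1# + 1#) · W (m ℤ.+ + n))
      ≈⟨ +-congˡ (-‿cong (trans ([1+1]·x≈x+x _) (sym (W[m+n+1]+W[m]≈W[m+n]+W[m+n] m)))) ⟩
        W m + - (W (m ℤ.+ + suc n) + W m)
      ≈˘⟨ +-congˡ (⁻¹-∙-comm _ _) ⟩
        W m + (- W (m ℤ.+ + suc n) + - W m)
      ≈˘⟨ +-assoc _ _ _ ⟩
        W m + - W (m ℤ.+ + suc n) + - W m
      ≈⟨ xyx⁻¹≈y _ _ ⟩
        - W (m ℤ.+ + suc n)
      ≈˘⟨ -1*x≈-x _ ⟩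
        - 1# · W (m ℤ.+ + suc n)
      ∎

    W[m]+W[m+n+1]≈2W[m+n] : ∀ m → 1# · W m + 1# · W (m ℤ.+ + suc n) ≈ (1# + 1#) · W (m ℤ.+ + n)
    W[m]+W[m+n+1]≈2W[m+n] m = begin
        1# · W m + 1# · W (m ℤ.+ + suc n)
      ≈⟨ trans (+-cong (*-identityˡ _) (*-identityˡ _)) (+-comm _ _) ⟩
        W (m ℤ.+ + suc n) + W m
      ≈⟨ W[m+n+1]+W[m]≈W[m+n]+W[m+n] m ⟩
        W (m ℤ.+ + n) + W (m ℤ.+ + n)
      ≈˘⟨ [1+1]·x≈x+x _ ⟩
        (1# + 1#) · W (m ℤ.+ + n)
      ∎

    2W[m]-W[m+1]≈W[m-n] : ∀ m → (1# + 1#) · W m + - 1# · W (m ℤ.+ + 1) ≈ 1# · W (m ℤ.- + n)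
    2W[m]-W[m+1]≈W[m-n] m = begin
        (1# + 1#) · W m + - 1# · W (m ℤ.+ + 1)
      ≈⟨ +-cong (trans ([1+1]·x≈x+x _) (sym (W[m+1]+W[m-n]≈W[m]+W[m] m))) (-1*x≈-x _) ⟩
        W (m ℤ.+ + 1) + W (m ℤ.- + n) + - W (m ℤ.+ + 1)
      ≈⟨ xyx⁻¹≈y _ _ ⟩
        W (m ℤ.- + n)
      ≈˘⟨ *-identityˡ _ ⟩
        1# · W (m ℤ.- + n)
      ∎

    identity₁ : ∀ k r →
      sumBelow R (suc k) (λ j → neg1^ R j · natR R (k C j) · two^ R j · W (r ℤ.- + (suc n * k) ℤ.+ + (n * j)))
        ≈ neg1^ R k · W r
    identity₁ k r = begin
        sumBelow R (suc k) (λ j → neg1^ R j · natR R (k C j) · two^ R j · W (m ℤ.+ + (n * j)))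
      ≈˘⟨ sumBelow-cong (suc k) binomialTerm≈ ⟩
        binomialSum k 1# (- 1# · (1# + 1#)) (λ j → W (m ℤ.+ + n ℤ.* + j))
      ≈⟨ binomialSum-recurrence W W[m]-2W[m+n]≈-W[m+n+1] k m ⟩
        (- 1#) ^ k · W (m ℤ.+ + suc n ℤ.* + k)
      ≈⟨ *-cong ([-1]^n≈neg1^n k) (W-cong ([r-ab]+ab≡r r (suc n) k)) ⟩
        neg1^ R k · W r
      ∎
      where
      m = r ℤ.- + (suc n * k)
      reorder : ∀ C s t X → C · ((s · t) · X) ≈ s · C · t · X
      reorder = solve 4 (λ C s t X → C :* ((s :* t) :* X) := s :* C :* t :* X) refl
      binomialTerm≈ : ∀ j →
        natR R (k C j) · (1# ^ (k ∸ j) · ((- 1# · (1# + 1#)) ^ j · W (m ℤ.+ + n ℤ.* + j)))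
          ≈ neg1^ R j · natR R (k C j) · two^ R j · W (m ℤ.+ + (n * j))
      binomialTerm≈ j = begin
          natR R (k C j) · (1# ^ (k ∸ j) · ((- 1# · (1# + 1#)) ^ j · W (m ℤ.+ + n ℤ.* + j)))
        ≈⟨ *-congˡ (trans (*-congʳ (1^n≈1 (k ∸ j))) (*-identityˡ _)) ⟩
          natR R (k C j) · ((- 1# · (1# + 1#)) ^ j · W (m ℤ.+ + n ℤ.* + j))
        ≈⟨ *-congˡ (*-cong (trans (^-distrib-* (- 1#) (1# + 1#) j) (*-cong ([-1]^n≈neg1^n j) (2^n≈two^n j)))
                           (W-cong (≡.cong (λ t → m ℤ.+ t) (≡.sym (ℤ.pos-* n j))))) ⟩
          natR R (k C j) · ((neg1^ R j · two^ R j) · W (m ℤ.+ + (n * j)))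
        ≈⟨ reorder _ _ _ _ ⟩
          neg1^ R j · natR R (k C j) · two^ R j · W (m ℤ.+ + (n * j))
        ∎

    identity₂ : ∀ k r →
      sumBelow R (suc k) (λ j → natR R (k C j) · W (r ℤ.- + (n * k) ℤ.+ + (suc n * j))) ≈ two^ R k · W r
    identity₂ k r = begin
        sumBelow R (suc k) (λ j → natR R (k C j) · W (m ℤ.+ + (suc n * j)))
      ≈˘⟨ sumBelow-cong (suc k) binomialTerm≈ ⟩
        binomialSum k 1# 1# (λ j → W (m ℤ.+ + suc n ℤ.* + j))
      ≈⟨ binomialSum-recurrence W W[m]+W[m+n+1]≈2W[m+n] k m ⟩
        (1# + 1#) ^ k · W (m ℤ.+ + n ℤ.* + k)
      ≈⟨ *-cong (2^n≈two^n k) (W-cong ([r-ab]+ab≡r r n k)) ⟩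
        two^ R k · W r
      ∎
      where
      m = r ℤ.- + (n * k)
      binomialTerm≈ : ∀ j →
        natR R (k C j) · (1# ^ (k ∸ j) · (1# ^ j · W (m ℤ.+ + suc n ℤ.* + j)))
          ≈ natR R (k C j) · W (m ℤ.+ + (suc n * j))
      binomialTerm≈ j = *-congˡ (begin
          1# ^ (k ∸ j) · (1# ^ j · W (m ℤ.+ + suc n ℤ.* + j))
        ≈⟨ *-cong (1^n≈1 (k ∸ j)) (*-congʳ (1^n≈1 j)) ⟩
          1# · (1# · W (m ℤ.+ + suc n ℤ.* + j))
        ≈⟨ trans (*-identityˡ _) (*-identityˡ _) ⟩
          W (m ℤ.+ + suc n ℤ.* + j)
        ≈˘⟨ W-cong (≡.cong (λ t → m ℤ.+ t) (ℤ.pos-* (suc n) j)) ⟩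
          W (m ℤ.+ + (suc n * j))
        ∎)

    identity₃ : ∀ k r →
      sumBelow R (suc k) (λ j → neg1^ R j · natR R (k C j) · two^ R (k ∸ j) · W (r ℤ.+ + (n * k) ℤ.+ + j))
        ≈ W r
    identity₃ k r = begin
        sumBelow R (suc k) (λ j → neg1^ R j · natR R (k C j) · two^ R (k ∸ j) · W (m ℤ.+ + j))
      ≈˘⟨ sumBelow-cong (suc k) binomialTerm≈ ⟩
        binomialSum k (1# + 1#) (- 1#) (λ j → W (m ℤ.+ + 1 ℤ.* + j))
      ≈⟨ binomialSum-recurrence W 2W[m]-W[m+1]≈W[m-n] k m ⟩
        1# ^ k · W (m ℤ.+ ℤ.- + n ℤ.* + k)
      ≈⟨ *-cong (1^n≈1 k) (W-cong ([r+ab]-ab≡r r n k)) ⟩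
        1# · W r
      ≈⟨ *-identityˡ _ ⟩
        W r
      ∎
      where
      m = r ℤ.+ + (n * k)
      reorder : ∀ C t s X → C · (t · (s · X)) ≈ s · C · t · X
      reorder = solve 4 (λ C t s X → C :* (t :* (s :* X)) := s :* C :* t :* X) refl
      binomialTerm≈ : ∀ j →
        natR R (k C j) · ((1# + 1#) ^ (k ∸ j) · ((- 1#) ^ j · W (m ℤ.+ + 1 ℤ.* + j)))
          ≈ neg1^ R j · natR R (k C j) · two^ R (k ∸ j) · W (m ℤ.+ + j)
      binomialTerm≈ j = trans
        (*-congˡ (*-cong (2^n≈two^n (k ∸ j)) (*-cong ([-1]^n≈neg1^n j)
          (W-cong (≡.cong (λ t → m ℤ.+ t) (ℤ.*-identityˡ (+ j)))))))
        (reorder _ _ _ _)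

theorem8 : {c ℓ : Level} (R : CommutativeRing c ℓ) →
    let open CommutativeRing R renaming (_*_ to _·_) in
    (n : ℕ) → 2 ≤ n → (W : ℤ → Carrier) → IsNStepFib R n W →
    (k : ℕ) → (r : ℤ) →
      (sumBelow R (suc k) (λ j → neg1^ R j · natR R (k C j) · two^ R j · W (r ℤ.- + (suc n * k) ℤ.+ + (n * j))) ≈ neg1^ R k · W r)
      × (sumBelow R (suc k) (λ j → natR R (k C j) · W (r ℤ.- + (n * k) ℤ.+ + (suc n * j))) ≈ two^ R k · W r)
      × (sumBelow R (suc k) (λ j → neg1^ R j · natR R (k C j) · two^ R (k ∸ j) · W (r ℤ.+ + (n * k) ℤ.+ + j)) ≈ W r)
theorem8 R (suc p) _ W fib k r =
  identity₁ R p W fib k r , identity₂ R p W fib k r , identity₃ R p W fib k r
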